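{- Let $F$ be a mixed graph. If $F\not\subseteq M(x,n)$ for all positive integers $n$ and all $x\in(0,1)$, then $\theta(F)=1$.
   Context: Mixed graphs: finite vertex set, at most one edge on each pair of distinct vertices, each edge undirected or directed (tail $\to$ head). $\alpha(G),\beta(G)$ are the numbers of undirected and directed edges divided by $\binom{v(G)}2$. $F\subseteq G$ means there is an injection $\phi:V(F)\to V(G)$ sending undirected edges of $F$ to pairs joined by an edge of either type and each directed edge $u\to v$ of $F$ to the directed edge $\phi(u)\to\phi(v)$ of $G$. $\theta(F)$ is the maximum $\rho$ with $\limsup_n\max\{\alpha(G)+\rho\beta(G):G\ F\text{ -free},\ v(G)=n\}\le1$ ($\theta(F)=\infty$ if $\max\beta(G)\to0$). For $n\in\mathbb Z_{>0}$ and $x\in(0,1)$, $M(x,n)$ is the $n$-vertex mixed graph consisting of an undirected complete graph $X$ on $\lfloor nx\rfloor$ vertices, an independent set $Y$ on $\lceil n(1-x)\rceil$ vertices, and a directed edge from every vertex of $X$ to every vertex of $Y$. -}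

module Defs where

open import Data.Nat as ℕ using (ℕ; zero; suc; _≥_)
open import Data.Nat.Combinatorics using (_C_)
open import Data.Integer as ℤ using (ℤ; +_)
open import Data.Rational as ℚ using (ℚ; _/_; floor; 0ℚ; 1ℚ)
open import Data.Fin using (Fin; toℕ; _≟_)
open import Data.Bool using (Bool; true; false; if_then_else_)
open import Data.Product using (Σ; ∃; _×_; _,_)
open import Function.Definitions using (Injective)
open import Relation.Binary.PropositionalEquality using (_≡_; _≢_; refl)
open import Relation.Nullary using (¬_; yes; no)

-- Mixed graphs on vertex set Fin n.
-- adj i j = none : no edge on {i,j}
-- adj i j = und  : undirected edge on {i,j}
-- adj i j = out  : directed edge i → j
-- adj i j = inn  : directed edge j → i

data Adj : Set where
  none und out inn : Adj

flipAdj : Adj → Adj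
flipAdj none = none
flipAdj und  = und
flipAdj out  = inn
flipAdj inn  = out

record MixedGraph (n : ℕ) : Set where
  field
    adj      : Fin n → Fin n → Adj
    loopless : ∀ i → adj i i ≡ none
    adjSym   : ∀ i j → adj j i ≡ flipAdj (adj i j)
open MixedGraph public

_⊆ᴹ_ : ∀ {k n} → MixedGraph k → MixedGraph n → Set
_⊆ᴹ_ {k} {n} F G =
  Σ (Fin k → Fin n) λ φ →
    Injective _≡_ _≡_ φ
    × (∀ i j → adj F i j ≡ und → adj G (φ i) (φ j) ≢ none)
    × (∀ i j → adj F i j ≡ out → adj G (φ i) (φ j) ≡ out)

sumFin : ∀ n → (Fin n → ℕ) → ℕ
sumFin zero    f = 0
sumFin (suc n) f = f Fin.zero ℕ.+ sumFin n (λ i → f (Fin.suc i))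
  where import Data.Fin as Fin

isUnd : Adj → ℕ
isUnd und = 1
isUnd _   = 0

isDir : Adj → ℕ
isDir out = 1
isDir inn = 1
isDir _   = 0

countPairs : ∀ {n} → (Adj → ℕ) → MixedGraph n → ℕ
countPairs {n} w G =
  sumFin n λ i → sumFin n λ j →
    if toℕ i ℕ.<ᵇ toℕ j then w (adj G i j) else 0

undEdges dirEdges : ∀ {n} → MixedGraph n → ℕ
undEdges = countPairs isUnd
dirEdges = countPairs isDir

-- e / (n choose 2); the value 0 when n choose 2 = 0 (n < 2) is irrelevant
-- since only large n matter.
density : ℕ → ℕ → ℚ
density e n with n C 2
... | zero  = 0ℚ
... | suc m = + e / suc m

α β : ∀ {n} → MixedGraph n → ℚ
α {n} G = density (undEdges G) n
β {n} G = density (dirEdges G) n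

-- ρ is admissible for θ(F):
--   limsup_n max{ α(G) + ρ β(G) : G F-free, v(G) = n } ≤ 1,
-- written out with ε/N.

Admissible : ∀ {k} → MixedGraph k → ℚ → Set
Admissible F ρ =
  ∀ (ε : ℚ) → ε ℚ.> 0ℚ →
    ∃ λ (N : ℕ) → ∀ (n : ℕ) → n ≥ N → (G : MixedGraph n) → ¬ (F ⊆ᴹ G) →
      α G ℚ.+ ρ ℚ.* β G ℚ.≤ 1ℚ ℚ.+ ε

-- θ(F) = 1 : 1 is admissible and no ρ > 1 is admissible
-- (admissibility is downward closed, so this says the maximum is exactly 1;
-- in particular θ(F) ≠ ∞).
ThetaIsOne : ∀ {k} → MixedGraph k → Set
ThetaIsOne F = Admissible F 1ℚ × (∀ (ρ : ℚ) → ρ ℚ.> 1ℚ → ¬ Admissible F ρ)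

-- M(x,n) with |X| = k: vertices i with toℕ i < k form X.

mAdj : Bool → Bool → Adj
mAdj true  true  = und
mAdj true  false = out
mAdj false true  = inn
mAdj false false = none

mAdjFlip : ∀ a b → mAdj b a ≡ flipAdj (mAdj a b)
mAdjFlip true  true  = refl
mAdjFlip true  false = refl
mAdjFlip false true  = refl
mAdjFlip false false = refl

Mk : (n k : ℕ) → MixedGraph n
Mk n k = record { adj = A ; loopless = L ; adjSym = S }
  where
    inX : Fin n → Bool
    inX i = toℕ i ℕ.<ᵇ k
    A : Fin n → Fin n → Adj
    A i j with i ≟ j
    ... | yes _ = none
    ... | no  _ = mAdj (inX i) (inX j)
    L : ∀ i → A i i ≡ none
    L i with i ≟ i
    ... | yes _ = refl
    ... | no ¬p with () ← ¬p refl
    S : ∀ i j → A j i ≡ flipAdj (A i j)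
    S i j with i ≟ j | j ≟ i
    ... | yes _ | yes _ = refl
    ... | yes p | no ¬q with () ← ¬q (Relation.Binary.PropositionalEquality.sym p)
    ... | no ¬p | yes q with () ← ¬p (Relation.Binary.PropositionalEquality.sym q)
    ... | no _  | no _  = mAdjFlip (inX i) (inX j)

-- M(x,n): |X| = ⌊n x⌋ (x ∈ (0,1), so n x ≥ 0 and the floor is a natural
-- number), |Y| = n − ⌊n x⌋ = ⌈n(1−x)⌉.
M : ℚ → (n : ℕ) → MixedGraph n
M x n = Mk n ℤ.∣ floor ((+ n / 1) ℚ.* x) ∣

module Submission where

-- A pair of vertices carries at most one edge, so α + β ≤ 1 for every mixed graph and ρ = 1 is
-- admissible.  For ρ = r/q > 1 the hypothesis makes every M(q/(q+1), (q+1)m) F-free; there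
-- |X| = qm and |Y| = m, so α + β = 1 − C(m,2)/C(n,2) and β = qm²/C(n,2), whence
--   α + ρβ ≥ α + β + β/q = 1 + C(m+1,2)/C(n,2) > 1 + 1/(q+1)²
-- for every m, and ρ is not admissible.

open import Defs
open import Data.Bool using (Bool; true; false; if_then_else_; T)
open import Data.Fin using (Fin; toℕ)
import Data.Fin as Fin
open import Data.Integer as ℤ using (+_; -[1+_]; +≤+; +<+)
import Data.Integer.Properties as ℤ
open import Data.Nat as ℕ using (ℕ; zero; suc; _+_; _*_; _<ᵇ_; _>_; z≤n; s≤s; NonZero)
import Data.Nat.Properties as ℕ
open import Data.Nat.Combinatorics using (_C_; nC1≡n; nCk+nC[k+1]≡[n+1]C[k+1])
open import Data.Nat.DivMod using (n/1≡n)
open import Data.Nat.Tactic.RingSolver using (solve-∀)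
open import Data.Product using (_,_; proj₁; proj₂)
open import Data.Rational as ℚ using (ℚ; mkℚ; _<_; 0ℚ; 1ℚ; toℚᵘ; floor)
import Data.Rational.Properties as ℚ
open import Data.Rational.Literals using (fromℤ)
import Data.Rational.Unnormalised as ℚᵘ
import Data.Rational.Unnormalised.Properties as ℚᵘ
open import Function using (_∘_; _⇔_; mk⇔; Equivalence)
open import Function.Properties.Equivalence using () renaming (trans to ⇔-trans)
open import Relation.Binary.PropositionalEquality
open import Relation.Nullary using (¬_; yes; no; contradiction)

suc-C2 : ∀ n → suc n C 2 ≡ n + n C 2
suc-C2 n = begin
  suc n C 2        ≡⟨ nCk+nC[k+1]≡[n+1]C[k+1] n 1 ⟨
  n C 1 + n C 2    ≡⟨ cong (_+ n C 2) (nC1≡n n) ⟩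
  n + n C 2        ∎
  where open ≡-Reasoning

C2-+ : ∀ a b → (a + b) C 2 ≡ a C 2 + a * b + b C 2
C2-+ zero    b = refl
C2-+ (suc a) b = begin
  suc (a + b) C 2                         ≡⟨ suc-C2 (a + b) ⟩
  (a + b) + (a + b) C 2                   ≡⟨ cong (_+_ (a + b)) (C2-+ a b) ⟩
  (a + b) + (a C 2 + a * b + b C 2)       ≡⟨ rearrange a b (a C 2) (b C 2) ⟩
  (a + a C 2) + suc a * b + b C 2         ≡⟨ cong (λ c → c + suc a * b + b C 2) (suc-C2 a) ⟨
  suc a C 2 + suc a * b + b C 2           ∎
  where
  open ≡-Reasoning
  rearrange : ∀ a b x y → (a + b) + (x + a * b + y) ≡ (a + x) + suc a * b + y
  rearrange = solve-∀

C2-double : ∀ n → 2 * (n C 2) + n ≡ n * n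
C2-double zero    = refl
C2-double (suc n) = begin
  2 * (suc n C 2) + suc n         ≡⟨ cong (λ c → 2 * c + suc n) (suc-C2 n) ⟩
  2 * (n + n C 2) + suc n         ≡⟨ rearrange n (n C 2) ⟩
  (2 * (n C 2) + n) + 2 * n + 1   ≡⟨ cong (λ c → c + 2 * n + 1) (C2-double n) ⟩
  n * n + 2 * n + 1               ≡⟨ square n ⟩
  suc n * suc n                   ∎
  where
  open ≡-Reasoning
  rearrange : ∀ n c → 2 * (n + c) + suc n ≡ (2 * c + n) + 2 * n + 1
  rearrange = solve-∀
  square : ∀ n → n * n + 2 * n + 1 ≡ suc n * suc n
  square = solve-∀

C2-scale-< : ∀ k m .{{_ : NonZero k}} .{{_ : NonZero m}} → (k * m) C 2 ℕ.< k * k * (suc m C 2)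
C2-scale-< k m = ℕ.*-cancelˡ-< 2 _ _ (begin-strict
  2 * ((k * m) C 2)                           <⟨ ℕ.m<m+n _ (ℕ.>-nonZero⁻¹ (k * m) {{ℕ.m*n≢0 k m}}) ⟩
  2 * ((k * m) C 2) + k * m                   ≤⟨ ℕ.m≤m+n _ (k * k * m) ⟩
  2 * ((k * m) C 2) + k * m + k * k * m       ≡⟨ cong (_+ k * k * m) (C2-double (k * m)) ⟩
  k * m * (k * m) + k * k * m                 ≡⟨ rearrange k m ⟩
  k * k * (m * m + m)                         ≡⟨ cong (λ c → k * k * (c + m)) (C2-double m) ⟨
  k * k * (2 * (m C 2) + m + m)               ≡⟨ rearrange′ k m (m C 2) ⟩
  2 * (k * k * (m + m C 2))                   ≡⟨ cong (λ c → 2 * (k * k * c)) (suc-C2 m) ⟨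
  2 * (k * k * (suc m C 2))                   ∎)
  where
  open ℕ.≤-Reasoning
  rearrange : ∀ k m → k * m * (k * m) + k * k * m ≡ k * k * (m * m + m)
  rearrange = solve-∀
  rearrange′ : ∀ k m c → k * k * (2 * c + m + m) ≡ 2 * (k * k * (m + c))
  rearrange′ = solve-∀

sumFin-cong : ∀ n {f g : Fin n → ℕ} → (∀ i → f i ≡ g i) → sumFin n f ≡ sumFin n g
sumFin-cong zero    f≡g = refl
sumFin-cong (suc n) f≡g = cong₂ _+_ (f≡g Fin.zero) (sumFin-cong n (f≡g ∘ Fin.suc))

sumFin-mono-≤ : ∀ n {f g : Fin n → ℕ} → (∀ i → f i ℕ.≤ g i) → sumFin n f ℕ.≤ sumFin n g
sumFin-mono-≤ zero    f≤g = z≤n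
sumFin-mono-≤ (suc n) f≤g = ℕ.+-mono-≤ (f≤g Fin.zero) (sumFin-mono-≤ n (f≤g ∘ Fin.suc))

sumFin-+ : ∀ n (f g : Fin n → ℕ) → sumFin n f + sumFin n g ≡ sumFin n (λ i → f i + g i)
sumFin-+ zero    f g = refl
sumFin-+ (suc n) f g = begin
  (f₀ + F) + (g₀ + G)     ≡⟨ interchange f₀ F g₀ G ⟩
  (f₀ + g₀) + (F + G)     ≡⟨ cong (_+_ (f₀ + g₀)) (sumFin-+ n (f ∘ Fin.suc) (g ∘ Fin.suc)) ⟩
  (f₀ + g₀) + sumFin n (λ i → f (Fin.suc i) + g (Fin.suc i)) ∎
  where
  open ≡-Reasoning
  f₀ = f Fin.zero
  g₀ = g Fin.zero
  F = sumFin n (f ∘ Fin.suc)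
  G = sumFin n (g ∘ Fin.suc)
  interchange : ∀ a b c d → (a + b) + (c + d) ≡ (a + c) + (b + d)
  interchange = solve-∀

sumFin-const : ∀ n c → sumFin n (λ _ → c) ≡ n * c
sumFin-const zero    c = refl
sumFin-const (suc n) c = cong (_+_ c) (sumFin-const n c)

sumFin-split : ∀ k t (g : Bool → ℕ) → sumFin (k + t) (λ j → g (toℕ j <ᵇ k)) ≡ k * g true + t * g false
sumFin-split zero    t g = sumFin-const t (g false)
sumFin-split (suc k) t g = trans (cong (_+_ (g true)) (sumFin-split k t g)) (sym (ℕ.+-assoc (g true) _ _))

sumPairs : ∀ n → (Fin n → Fin n → ℕ) → ℕ
sumPairs n f = sumFin n λ i → sumFin n λ j → if toℕ i <ᵇ toℕ j then f i j else 0

sumPairs-cong : ∀ n {f g : Fin n → Fin n → ℕ} → (∀ i j → toℕ i ℕ.< toℕ j → f i j ≡ g i j) →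
                sumPairs n f ≡ sumPairs n g
sumPairs-cong n {f} {g} f≡g = sumFin-cong n λ i → sumFin-cong n λ j → above-diagonal i j
  where
  above-diagonal : ∀ i j → (if toℕ i <ᵇ toℕ j then f i j else 0) ≡ (if toℕ i <ᵇ toℕ j then g i j else 0)
  above-diagonal i j with toℕ i <ᵇ toℕ j in i<ᵇj
  ... | true  = f≡g i j (ℕ.<ᵇ⇒< (toℕ i) (toℕ j) (subst T (sym i<ᵇj) _))
  ... | false = refl

sumPairs-mono-≤ : ∀ n {f g : Fin n → Fin n → ℕ} → (∀ i j → f i j ℕ.≤ g i j) → sumPairs n f ℕ.≤ sumPairs n g
sumPairs-mono-≤ n {f} {g} f≤g = sumFin-mono-≤ n λ i → sumFin-mono-≤ n λ j → above-diagonal i j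
  where
  above-diagonal : ∀ i j → (if toℕ i <ᵇ toℕ j then f i j else 0) ℕ.≤ (if toℕ i <ᵇ toℕ j then g i j else 0)
  above-diagonal i j with toℕ i <ᵇ toℕ j
  ... | true  = f≤g i j
  ... | false = z≤n

sumPairs-+ : ∀ n (f g : Fin n → Fin n → ℕ) → sumPairs n f + sumPairs n g ≡ sumPairs n (λ i j → f i j + g i j)
sumPairs-+ n f g = trans (sumFin-+ n _ _) (sumFin-cong n λ i → trans (sumFin-+ n _ _) (sumFin-cong n (above-diagonal i)))
  where
  above-diagonal : ∀ i j → (if toℕ i <ᵇ toℕ j then f i j else 0) + (if toℕ i <ᵇ toℕ j then g i j else 0)
                         ≡ (if toℕ i <ᵇ toℕ j then f i j + g i j else 0)
  above-diagonal i j with toℕ i <ᵇ toℕ j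
  ... | true  = refl
  ... | false = refl

sumPairs-const : ∀ n c → sumPairs n (λ _ _ → c) ≡ (n C 2) * c
sumPairs-const zero    c = refl
sumPairs-const (suc n) c = begin
  sumFin n (λ _ → c) + sumPairs n (λ _ _ → c)   ≡⟨ cong₂ _+_ (sumFin-const n c) (sumPairs-const n c) ⟩
  n * c + (n C 2) * c                           ≡⟨ ℕ.*-distribʳ-+ c n (n C 2) ⟨
  (n + n C 2) * c                               ≡⟨ cong (_* c) (suc-C2 n) ⟨
  (suc n C 2) * c                               ∎
  where open ≡-Reasoning

sumPairs-block : ∀ k t (h : Bool → Bool → ℕ) →
  sumPairs (k + t) (λ i j → h (toℕ i <ᵇ k) (toℕ j <ᵇ k))
    ≡ (k C 2) * h true true + k * t * h true false + (t C 2) * h false false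
sumPairs-block zero    t h = sumPairs-const t (h false false)
sumPairs-block (suc k) t h = begin
  sumFin (k + t) (λ j → h true (toℕ j <ᵇ k)) + sumPairs (k + t) (λ i j → h (toℕ i <ᵇ k) (toℕ j <ᵇ k))
      ≡⟨ cong₂ _+_ (sumFin-split k t (h true)) (sumPairs-block k t h) ⟩
  (k * h true true + t * h true false) + ((k C 2) * h true true + k * t * h true false + (t C 2) * h false false)
      ≡⟨ rearrange k t (k C 2) (t C 2) (h true true) (h true false) (h false false) ⟩
  (k + k C 2) * h true true + suc k * t * h true false + (t C 2) * h false false
      ≡⟨ cong (λ c → c * h true true + suc k * t * h true false + (t C 2) * h false false) (suc-C2 k) ⟨
  (suc k C 2) * h true true + suc k * t * h true false + (t C 2) * h false false ∎
  where
  open ≡-Reasoning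
  rearrange : ∀ k t a b x y z → (k * x + t * y) + (a * x + k * t * y + b * z) ≡ (k + a) * x + suc k * t * y + b * z
  rearrange = solve-∀

und+dir≤1 : ∀ e → isUnd e + isDir e ℕ.≤ 1
und+dir≤1 none = z≤n
und+dir≤1 und  = s≤s z≤n
und+dir≤1 out  = s≤s z≤n
und+dir≤1 inn  = s≤s z≤n

edges-≤ : ∀ {n} (G : MixedGraph n) → undEdges G + dirEdges G ℕ.≤ n C 2
edges-≤ {n} G = begin
  undEdges G + dirEdges G                                       ≡⟨ sumPairs-+ n _ _ ⟩
  sumPairs n (λ i j → isUnd (adj G i j) + isDir (adj G i j))   ≤⟨ sumPairs-mono-≤ n (λ i j → und+dir≤1 (adj G i j)) ⟩
  sumPairs n (λ _ _ → 1)                                        ≡⟨ sumPairs-const n 1 ⟩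
  (n C 2) * 1                                                   ≡⟨ ℕ.*-identityʳ (n C 2) ⟩
  n C 2                                                         ∎
  where open ℕ.≤-Reasoning

Mk-adj : ∀ n k {i j : Fin n} → i ≢ j → adj (Mk n k) i j ≡ mAdj (toℕ i <ᵇ k) (toℕ j <ᵇ k)
Mk-adj n k {i} {j} i≢j with i Fin.≟ j
... | yes i≡j = contradiction i≡j i≢j
... | no  _   = refl

Mk-countPairs : ∀ k t (w : Adj → ℕ) →
  countPairs w (Mk (k + t) k) ≡ (k C 2) * w und + k * t * w out + (t C 2) * w none
Mk-countPairs k t w = trans
  (sumPairs-cong (k + t) λ i j i<j → cong w (Mk-adj (k + t) k (ℕ.<⇒≢ i<j ∘ cong toℕ)))
  (sumPairs-block k t (λ a b → w (mAdj a b)))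

Mk-undEdges : ∀ k t → undEdges (Mk (k + t) k) ≡ k C 2
Mk-undEdges k t = trans (Mk-countPairs k t isUnd) (keep-first (k C 2) (k * t) (t C 2))
  where
  keep-first : ∀ x y z → x * 1 + y * 0 + z * 0 ≡ x
  keep-first = solve-∀

Mk-dirEdges : ∀ k t → dirEdges (Mk (k + t) k) ≡ k * t
Mk-dirEdges k t = trans (Mk-countPairs k t isDir) (keep-second (k C 2) (k * t) (t C 2))
  where
  keep-second : ∀ x y z → x * 0 + y * 1 + z * 0 ≡ y
  keep-second = solve-∀

fracᵘ-+ : ∀ a c {b d} .{{_ : NonZero b}} .{{_ : NonZero d}} →
  + a ℚᵘ./ b ℚᵘ.+ + c ℚᵘ./ d ≡ (+ (a * d + c * b) ℚᵘ./ (b * d)) {{ℕ.m*n≢0 b d}}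
fracᵘ-+ a c {suc b} {suc d} = cong (ℚᵘ._/ (suc b * suc d))
  (sym (trans (ℤ.pos-+ (a * suc d) (c * suc b)) (cong₂ ℤ._+_ (ℤ.pos-* a (suc d)) (ℤ.pos-* c (suc b)))))

fracᵘ-* : ∀ a c {b d} .{{_ : NonZero b}} .{{_ : NonZero d}} →
  (+ a ℚᵘ./ b) ℚᵘ.* (+ c ℚᵘ./ d) ≡ (+ (a * c) ℚᵘ./ (b * d)) {{ℕ.m*n≢0 b d}}
fracᵘ-* a c {suc b} {suc d} = cong (ℚᵘ._/ (suc b * suc d)) (sym (ℤ.pos-* a c))

fracᵘ-≃ : ∀ {a b c d} .{{_ : NonZero b}} .{{_ : NonZero d}} →
  a * d ≡ c * b → + a ℚᵘ./ b ℚᵘ.≃ + c ℚᵘ./ d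
fracᵘ-≃ {a} {suc b} {c} {suc d} eq =
  ℚᵘ.*≡* (trans (sym (ℤ.pos-* a (suc d))) (trans (cong +_ eq) (ℤ.pos-* c (suc b))))

fracᵘ-≤⇔ : ∀ {a b c d} .{{_ : NonZero b}} .{{_ : NonZero d}} →
  (+ a ℚᵘ./ b ℚᵘ.≤ + c ℚᵘ./ d) ⇔ (a * d ℕ.≤ c * b)
fracᵘ-≤⇔ {a} {suc b} {c} {suc d} = mk⇔
  (λ { (ℚᵘ.*≤* le) → ℤ.drop‿+≤+ (subst₂ ℤ._≤_ (sym (ℤ.pos-* a (suc d))) (sym (ℤ.pos-* c (suc b))) le) })
  (λ le → ℚᵘ.*≤* (subst₂ ℤ._≤_ (ℤ.pos-* a (suc d)) (ℤ.pos-* c (suc b)) (+≤+ le)))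

fracᵘ-<⇔ : ∀ {a b c d} .{{_ : NonZero b}} .{{_ : NonZero d}} →
  (+ a ℚᵘ./ b ℚᵘ.< + c ℚᵘ./ d) ⇔ (a * d ℕ.< c * b)
fracᵘ-<⇔ {a} {suc b} {c} {suc d} = mk⇔
  (λ { (ℚᵘ.*<* lt) → ℤ.drop‿+<+ (subst₂ ℤ._<_ (sym (ℤ.pos-* a (suc d))) (sym (ℤ.pos-* c (suc b))) lt) })
  (λ lt → ℚᵘ.*<* (subst₂ ℤ._<_ (ℤ.pos-* a (suc d)) (ℤ.pos-* c (suc b)) (+<+ lt)))

toℚᵘ-frac : ∀ a b .{{_ : NonZero b}} → toℚᵘ (+ a ℚ./ b) ℚᵘ.≃ + a ℚᵘ./ b
toℚᵘ-frac a (suc b) = ℚ.toℚᵘ-fromℚᵘ (+ a ℚᵘ./ suc b)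

floor-fromℤ : ∀ j → ℤ.∣ floor (fromℤ (+ j)) ∣ ≡ j
floor-fromℤ j = cong ℤ.∣_∣ (trans (ℤ.*-identityˡ _) (cong +_ (n/1≡n j)))

toℚᵘ-≤⇔ : ∀ {p q x y} → toℚᵘ p ℚᵘ.≃ x → toℚᵘ q ℚᵘ.≃ y → (p ℚ.≤ q) ⇔ (x ℚᵘ.≤ y)
toℚᵘ-≤⇔ p≃x q≃y = mk⇔
  (λ p≤q → ℚᵘ.≤-respʳ-≃ q≃y (ℚᵘ.≤-respˡ-≃ p≃x (ℚ.toℚᵘ-mono-≤ p≤q)))
  (λ x≤y → ℚ.toℚᵘ-cancel-≤ (ℚᵘ.≤-respʳ-≃ (ℚᵘ.≃-sym q≃y) (ℚᵘ.≤-respˡ-≃ (ℚᵘ.≃-sym p≃x) x≤y)))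

toℚᵘ-<⇔ : ∀ {p q x y} → toℚᵘ p ℚᵘ.≃ x → toℚᵘ q ℚᵘ.≃ y → (p < q) ⇔ (x ℚᵘ.< y)
toℚᵘ-<⇔ p≃x q≃y = mk⇔
  (λ p<q → ℚᵘ.<-respʳ-≃ q≃y (ℚᵘ.<-respˡ-≃ p≃x (ℚ.toℚᵘ-mono-< p<q)))
  (λ x<y → ℚ.toℚᵘ-cancel-< (ℚᵘ.<-respʳ-≃ (ℚᵘ.≃-sym q≃y) (ℚᵘ.<-respˡ-≃ (ℚᵘ.≃-sym p≃x) x<y)))

frac-<⇔ : ∀ a b c d .{{_ : NonZero b}} .{{_ : NonZero d}} →
  (+ a ℚ./ b < + c ℚ./ d) ⇔ (a * d ℕ.< c * b)
frac-<⇔ a b c d = ⇔-trans (toℚᵘ-<⇔ (toℚᵘ-frac a b) (toℚᵘ-frac c d)) fracᵘ-<⇔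

toℚᵘ-affine : ∀ u v r {d q} .{{_ : NonZero d}} .{{_ : NonZero q}} →
  toℚᵘ (+ u ℚ./ d ℚ.+ (+ r ℚ./ q) ℚ.* (+ v ℚ./ d)) ℚᵘ.≃ (+ (u * q + r * v) ℚᵘ./ (q * d)) {{ℕ.m*n≢0 q d}}
toℚᵘ-affine u v r {d@(suc _)} {q@(suc _)} = begin
  toℚᵘ (+ u ℚ./ d ℚ.+ (+ r ℚ./ q) ℚ.* (+ v ℚ./ d))
    ≈⟨ ℚ.toℚᵘ-homo-+ (+ u ℚ./ d) ((+ r ℚ./ q) ℚ.* (+ v ℚ./ d)) ⟩
  toℚᵘ (+ u ℚ./ d) ℚᵘ.+ toℚᵘ ((+ r ℚ./ q) ℚ.* (+ v ℚ./ d))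
    ≈⟨ ℚᵘ.+-cong (toℚᵘ-frac u d) (ℚᵘ.≃-trans (ℚ.toℚᵘ-homo-* (+ r ℚ./ q) (+ v ℚ./ d)) (ℚᵘ.*-cong (toℚᵘ-frac r q) (toℚᵘ-frac v d))) ⟩
  + u ℚᵘ./ d ℚᵘ.+ (+ r ℚᵘ./ q) ℚᵘ.* (+ v ℚᵘ./ d)
    ≡⟨ cong (+ u ℚᵘ./ d ℚᵘ.+_) (fracᵘ-* r v) ⟩
  + u ℚᵘ./ d ℚᵘ.+ + (r * v) ℚᵘ./ (q * d)
    ≡⟨ fracᵘ-+ u (r * v) ⟩
  + (u * (q * d) + r * v * d) ℚᵘ./ (d * (q * d))
    ≈⟨ fracᵘ-≃ (cancel-d u v r d q) ⟩
  + (u * q + r * v) ℚᵘ./ (q * d) ∎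
  where
  open ℚᵘ.≃-Reasoning
  cancel-d : ∀ u v r d q → (u * (q * d) + r * v * d) * (q * d) ≡ (u * q + r * v) * (d * (q * d))
  cancel-d = solve-∀

affine-≤⇔ : ∀ u d r q v a b .{{_ : NonZero d}} .{{_ : NonZero q}} .{{_ : NonZero b}} →
  (+ u ℚ./ d ℚ.+ (+ r ℚ./ q) ℚ.* (+ v ℚ./ d) ℚ.≤ + a ℚ./ b) ⇔ ((u * q + r * v) * b ℕ.≤ a * (q * d))
affine-≤⇔ u d r q v a b =
  ⇔-trans (toℚᵘ-≤⇔ (toℚᵘ-affine u v r) (toℚᵘ-frac a b)) (fracᵘ-≤⇔ {{ℕ.m*n≢0 q d}})

1+frac : ∀ a b .{{_ : NonZero b}} → 1ℚ ℚ.+ + a ℚ./ b ≡ + (b + a) ℚ./ b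
1+frac a b@(suc _) = ℚ.toℚᵘ-injective (begin
  toℚᵘ (1ℚ ℚ.+ + a ℚ./ b)            ≈⟨ ℚᵘ.≃-trans (ℚ.toℚᵘ-homo-+ 1ℚ (+ a ℚ./ b)) (ℚᵘ.+-congʳ ℚᵘ.1ℚᵘ (toℚᵘ-frac a b)) ⟩
  + 1 ℚᵘ./ 1 ℚᵘ.+ + a ℚᵘ./ b          ≡⟨ fracᵘ-+ 1 a {1} {b} ⟩
  + (1 * b + a * 1) ℚᵘ./ (1 * b)      ≈⟨ fracᵘ-≃ (rearrange a b) ⟩
  + (b + a) ℚᵘ./ b                     ≈⟨ ℚᵘ.≃-sym (toℚᵘ-frac (b + a) b) ⟩
  toℚᵘ (+ (b + a) ℚ./ b)              ∎)
  where
  open ℚᵘ.≃-Reasoning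
  rearrange : ∀ a b → (1 * b + a * 1) * b ≡ (b + a) * (1 * b)
  rearrange = solve-∀

floor-scale : ∀ a k m .{{_ : NonZero k}} → ℤ.∣ floor ((+ (k * m) ℚ./ 1) ℚ.* (+ a ℚ./ k)) ∣ ≡ a * m
floor-scale a k@(suc _) m = trans (cong (ℤ.∣_∣ ∘ floor) (ℚ.toℚᵘ-injective {y = fromℤ (+ (a * m))} (begin
  toℚᵘ ((+ (k * m) ℚ./ 1) ℚ.* (+ a ℚ./ k))    ≈⟨ ℚᵘ.≃-trans (ℚ.toℚᵘ-homo-* (+ (k * m) ℚ./ 1) (+ a ℚ./ k)) (ℚᵘ.*-cong (toℚᵘ-frac (k * m) 1) (toℚᵘ-frac a k)) ⟩
  (+ (k * m) ℚᵘ./ 1) ℚᵘ.* (+ a ℚᵘ./ k)         ≡⟨ fracᵘ-* (k * m) a {1} {k} ⟩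
  + (k * m * a) ℚᵘ./ (1 * k)                    ≈⟨ fracᵘ-≃ (rearrange a k m) ⟩
  + (a * m) ℚᵘ./ 1                              ∎))) (floor-fromℤ (a * m))
  where
  open ℚᵘ.≃-Reasoning
  rearrange : ∀ a k m → k * m * a * 1 ≡ a * m * (1 * k)
  rearrange = solve-∀

C2-nonZero : ∀ {n} → 2 ℕ.≤ n → NonZero (n C 2)
C2-nonZero {suc (suc k)} (s≤s (s≤s _)) = subst NonZero (sym (suc-C2 (suc k))) _

density-≡ : ∀ e n .{{_ : NonZero (n C 2)}} → density e n ≡ + e ℚ./ (n C 2)
density-≡ e n = at (n C 2) refl
  where
  at : ∀ c → n C 2 ≡ c → .{{_ : NonZero c}} → density e n ≡ + e ℚ./ c
  at (suc c) n₂≡c with n C 2 | n₂≡c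
  ... | _ | refl = refl

α+β≤1 : ∀ {n} → 2 ℕ.≤ n → (G : MixedGraph n) → α G ℚ.+ 1ℚ ℚ.* β G ℚ.≤ 1ℚ
α+β≤1 {n} n≥2 G = subst₂ (λ a b → a ℚ.+ 1ℚ ℚ.* b ℚ.≤ 1ℚ) (sym (density-≡ u n)) (sym (density-≡ v n))
  (Equivalence.from (affine-≤⇔ u (n C 2) 1 1 v 1 1) (subst₂ ℕ._≤_ (lhs u v) (rhs (n C 2)) (edges-≤ G)))
  where
  instance
    _ : NonZero (n C 2)
    _ = C2-nonZero n≥2
  u = undEdges G
  v = dirEdges G
  lhs : ∀ u v → u + v ≡ (u * 1 + 1 * v) * 1
  lhs = solve-∀
  rhs : ∀ d → d ≡ 1 * (1 * d)
  rhs = solve-∀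

admissible-1 : ∀ {k} (F : MixedGraph k) → Admissible F 1ℚ
admissible-1 F ε ε>0 = 2 , λ n n≥2 G _ → ℚ.≤-trans (α+β≤1 n≥2 G)
  (subst (ℚ._≤ 1ℚ ℚ.+ ε) (ℚ.+-identityʳ 1ℚ) (ℚ.+-monoʳ-≤ 1ℚ (ℚ.<⇒≤ ε>0)))

Mk-excess : ∀ q m r .{{_ : NonZero q}} .{{_ : NonZero m}} → q ℕ.< r →
  (suc q * suc q + 1) * (q * ((q * m + m) C 2)) ℕ.< (((q * m) C 2) * q + r * (q * m * m)) * (suc q * suc q)
Mk-excess q m r q<r = begin-strict
  (E + 1) * (q * d)                      ≡⟨ rearrange E q d ⟩
  E * (q * d) + q * d                    <⟨ ℕ.+-monoʳ-< (E * (q * d)) (ℕ.*-monoʳ-< q d<E*S) ⟩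
  E * (q * d) + q * (E * S)              ≡⟨ rearrange′ E q d S ⟩
  q * (d + S) * E                        ≡⟨ cong (_* E) gain ⟩
  (U * q + suc q * D) * E                ≤⟨ ℕ.*-monoˡ-≤ E (ℕ.+-monoʳ-≤ (U * q) (ℕ.*-monoˡ-≤ D q<r)) ⟩
  (U * q + r * D) * E                    ∎
  where
  open ℕ.≤-Reasoning
  E = suc q * suc q
  U = (q * m) C 2
  D = q * m * m
  d = (q * m + m) C 2
  S = suc m C 2
  d<E*S : d ℕ.< E * S
  d<E*S = subst (λ n → n C 2 ℕ.< E * S) (ℕ.+-comm m (q * m)) (C2-scale-< (suc q) m)
  rearrange : ∀ E q d → (E + 1) * (q * d) ≡ E * (q * d) + q * d
  rearrange = solve-∀
  rearrange′ : ∀ E q d S → E * (q * d) + q * (E * S) ≡ q * (d + S) * E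
  rearrange′ = solve-∀
  gain : q * (d + S) ≡ U * q + suc q * D
  gain = begin-equality
    q * (d + S)                                        ≡⟨ cong₂ (λ a b → q * (a + b)) (C2-+ (q * m) m) (suc-C2 m) ⟩
    q * ((U + D + m C 2) + (m + m C 2))                ≡⟨ regroup q m U (m C 2) ⟩
    U * q + q * D + q * (2 * (m C 2) + m)              ≡⟨ cong (λ c → U * q + q * D + q * c) (C2-double m) ⟩
    U * q + q * D + q * (m * m)                        ≡⟨ regroup′ q m U ⟩
    U * q + suc q * D                                  ∎
    where
    regroup : ∀ q m U C → q * ((U + q * m * m + C) + (m + C)) ≡ U * q + q * (q * m * m) + q * (2 * C + m)
    regroup = solve-∀
    regroup′ : ∀ q m U → U * q + q * (q * m * m) + q * (m * m) ≡ U * q + suc q * (q * m * m)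
    regroup′ = solve-∀

M-as-Mk : ∀ q m → M (+ q ℚ./ suc q) (q * m + m) ≡ Mk (q * m + m) (q * m)
M-as-Mk q m = cong (Mk (q * m + m)) (begin
  ℤ.∣ floor ((+ (q * m + m) ℚ./ 1) ℚ.* (+ q ℚ./ suc q)) ∣   ≡⟨ cong (λ n → ℤ.∣ floor ((+ n ℚ./ 1) ℚ.* (+ q ℚ./ suc q)) ∣) (ℕ.+-comm (q * m) m) ⟩
  ℤ.∣ floor ((+ (suc q * m) ℚ./ 1) ℚ.* (+ q ℚ./ suc q)) ∣  ≡⟨ floor-scale q (suc q) m ⟩
  q * m                                                      ∎)
  where open ≡-Reasoning

Mk-α : ∀ k t .{{_ : NonZero ((k + t) C 2)}} → α (Mk (k + t) k) ≡ + (k C 2) ℚ./ ((k + t) C 2)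
Mk-α k t = trans (cong (λ e → density e (k + t)) (Mk-undEdges k t)) (density-≡ (k C 2) (k + t))

Mk-β : ∀ k t .{{_ : NonZero ((k + t) C 2)}} → β (Mk (k + t) k) ≡ + (k * t) ℚ./ ((k + t) C 2)
Mk-β k t = trans (cong (λ e → density e (k + t)) (Mk-dirEdges k t)) (density-≡ (k * t) (k + t))

0<q/[1+q] : ∀ q .{{_ : NonZero q}} → 0ℚ < + q ℚ./ suc q
0<q/[1+q] (suc q) = Equivalence.from (frac-<⇔ 0 1 (suc q) (suc (suc q))) (s≤s z≤n)

q/[1+q]<1 : ∀ q → + q ℚ./ suc q < 1ℚ
q/[1+q]<1 q = Equivalence.from (frac-<⇔ q (suc q) 1 1)
  (subst₂ ℕ._<_ (sym (ℕ.*-identityʳ q)) (sym (ℕ.*-identityˡ (suc q))) (ℕ.n<1+n q))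

1<r/q⇒q<r : ∀ r q .{{_ : NonZero q}} → 1ℚ < + r ℚ./ q → q ℕ.< r
1<r/q⇒q<r r q 1<r/q = subst₂ ℕ._<_ (ℕ.*-identityˡ q) (ℕ.*-identityʳ r) (Equivalence.to (frac-<⇔ 1 1 r q) 1<r/q)

inadmissible-above-1 : ∀ {k} (F : MixedGraph k) →
  (∀ (n : ℕ) → n > 0 → ∀ (x : ℚ) → 0ℚ < x → x < 1ℚ → ¬ (F ⊆ᴹ M x n)) →
  ∀ ρ → ρ ℚ.> 1ℚ → ¬ Admissible F ρ
inadmissible-above-1 F M-free (mkℚ -[1+ _ ] _ _) (ℚ.*<* ())
inadmissible-above-1 F M-free ρ@(mkℚ (+ r) q-1 _) ρ>1 adm =
  ℕ.<⇒≱ (Mk-excess q m r q<r) (Equivalence.to (affine-≤⇔ U (n C 2) r q D (E + 1) E) as-fractions)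
  where
  q = suc q-1
  E = suc q * suc q
  ε>0 : 0ℚ < + 1 ℚ./ E
  ε>0 = Equivalence.from (frac-<⇔ 0 1 1 E) (s≤s z≤n)
  N = proj₁ (adm (+ 1 ℚ./ E) ε>0)
  m = suc N
  n = q * m + m
  U = (q * m) C 2
  D = q * m * m
  instance
    _ : NonZero (n C 2)
    _ = C2-nonZero {n} (ℕ.+-mono-≤ {1} {q * m} {1} {m} (s≤s z≤n) (s≤s z≤n))
  ρ≡r/q : ρ ≡ + r ℚ./ q
  ρ≡r/q = sym (ℚ.↥p/↧p≡p ρ)
  q<r : q ℕ.< r
  q<r = 1<r/q⇒q<r r q (subst (1ℚ <_) ρ≡r/q ρ>1)
  Mk-free : ¬ (F ⊆ᴹ Mk n (q * m))
  Mk-free = subst (λ G → ¬ (F ⊆ᴹ G)) (M-as-Mk q m) (M-free n (s≤s z≤n) _ (0<q/[1+q] q) (q/[1+q]<1 q))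
  Mk-bound : α (Mk n (q * m)) ℚ.+ ρ ℚ.* β (Mk n (q * m)) ℚ.≤ 1ℚ ℚ.+ + 1 ℚ./ E
  Mk-bound = proj₂ (adm (+ 1 ℚ./ E) ε>0) n (ℕ.≤-trans (ℕ.n≤1+n N) (ℕ.m≤n+m m (q * m))) (Mk n (q * m)) Mk-free
  as-fractions : + U ℚ./ (n C 2) ℚ.+ (+ r ℚ./ q) ℚ.* (+ D ℚ./ (n C 2)) ℚ.≤ + (E + 1) ℚ./ E
  as-fractions = subst₂ ℚ._≤_
    (cong₂ ℚ._+_ (Mk-α (q * m) m) (cong₂ ℚ._*_ ρ≡r/q (Mk-β (q * m) m))) (1+frac 1 E) Mk-bound

proposition3p3 : ∀ {k : ℕ} (F : MixedGraph k) →
    (∀ (n : ℕ) → n > 0 → ∀ (x : ℚ) → 0ℚ < x → x < 1ℚ → ¬ (F ⊆ᴹ M x n)) →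
    ThetaIsOne F
proposition3p3 F M-free = admissible-1 F , inadmissible-above-1 F M-free
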